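{- Let $M$ be a finite simple graph and let $a,b$ be two non-adjacent vertices of $M$. Suppose that every vertex of $N_M(a)\cap N_M(b)$ is adjacent to every other vertex of $M$, and that either every vertex of $N_M(a)\setminus N_M(b)$ is adjacent to every vertex of $N_M(b)$, or every vertex of $N_M(b)\setminus N_M(a)$ is adjacent to every vertex of $N_M(a)$. Let $M_1$ be the graph obtained from $M$ by adding two new vertices $c,d$ and the edges $ab,bc,cd,ad$, and let $M_2$ be the graph obtained from $M$ by adding two new vertices $c,d$ and the edges $ac,bc,ad,bd$. Then $J(M_1;x,y)=J(M_2;x,y)$.
   Context: For a finite simple graph $H$ and $W\subseteq V(H)$, $N_H[W]$ is the set of vertices that are in $W$ or adjacent to a vertex of $W$, and $N_H(W):=N_H[W]\setminus W$; for a vertex $a$, $N_H(a)$ is its set of neighbours in $H$. The bivariate domination polynomial is $J(H;x,y):=\sum_{W\subseteq V(H)} x^{|W|}y^{|N_H(W)|}$. -}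

module Defs where

open import Data.Nat using (ℕ; zero; suc)
open import Data.Bool using (Bool; true; false; _∧_; _∨_; not)
open import Data.Fin using (Fin; zero; suc)
open import Data.Fin.Properties using (_≟_)
open import Data.List using (List; []; _∷_; map; _++_; length; filterᵇ; allFin)
open import Data.Bool.ListAction using () renaming (any to anyL)
open import Data.Vec using (Vec; []; _∷_; lookup)
open import Data.Product using (_×_)
open import Relation.Nullary.Decidable using (⌊_⌋)
open import Relation.Binary.PropositionalEquality using (_≡_; _≢_)

record SimpleGraph (n : ℕ) : Set where
  field
    adj     : Fin n → Fin n → Bool
    sym     : ∀ u v → adj u v ≡ adj v u
    irrefl  : ∀ v → adj v v ≡ false
open SimpleGraph public

Subset : ℕ → Set
Subset n = Vec Bool n

subsets : (n : ℕ) → List (Subset n)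
subsets zero    = [] ∷ []
subsets (suc n) = map (true ∷_) (subsets n) ++ map (false ∷_) (subsets n)

countᵇ : {n : ℕ} → (Fin n → Bool) → ℕ
countᵇ {n} p = length (filterᵇ p (allFin n))

card : {n : ℕ} → Subset n → ℕ
card W = countᵇ (lookup W)

inOpenNbhd : {n : ℕ} → (Fin n → Fin n → Bool) → Subset n → Fin n → Bool
inOpenNbhd {n} adj W v =
  not (lookup W v) ∧ anyL (λ w → lookup W w ∧ adj w v) (allFin n)

nbhdCard : {n : ℕ} → (Fin n → Fin n → Bool) → Subset n → ℕ
nbhdCard adj W = countᵇ (inOpenNbhd adj W)

-- The bivariate domination polynomial J(H;x,y) = Σ_W x^|W| y^|N(W)|,
-- represented by its coefficient function: J adj i j is the coefficient
-- of x^i y^j, i.e. the number of W ⊆ V(H) with |W| = i and |N(W)| = j.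
-- Two such polynomials are equal iff all coefficients agree.
J : {n : ℕ} → (Fin n → Fin n → Bool) → ℕ → ℕ → ℕ
J {n} adj i j =
  length (filterᵇ (λ W → ⌊ card W Data.Nat.≟ i ⌋ ∧ ⌊ nbhdCard adj W Data.Nat.≟ j ⌋)
                  (subsets n))

_==_ : {n : ℕ} → Fin n → Fin n → Bool
u == v = ⌊ u ≟ v ⌋

-- Vertex set of M₁ and M₂: Fin (2 + n); vertex 0 is c, vertex 1 is d,
-- and suc (suc v) is the old vertex v of M.

adjM₁ : {n : ℕ} → SimpleGraph n → Fin n → Fin n → Fin (suc (suc n)) → Fin (suc (suc n)) → Bool
adjM₁ M a b zero zero = false
adjM₁ M a b zero (suc zero) = true
adjM₁ M a b (suc zero) zero = true
adjM₁ M a b (suc zero) (suc zero) = false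
adjM₁ M a b zero (suc (suc v)) = v == b
adjM₁ M a b (suc (suc v)) zero = v == b
adjM₁ M a b (suc zero) (suc (suc v)) = v == a
adjM₁ M a b (suc (suc v)) (suc zero) = v == a
adjM₁ M a b (suc (suc u)) (suc (suc v)) =
  adj M u v ∨ ((u == a) ∧ (v == b)) ∨ ((u == b) ∧ (v == a))

adjM₂ : {n : ℕ} → SimpleGraph n → Fin n → Fin n → Fin (suc (suc n)) → Fin (suc (suc n)) → Bool
adjM₂ M a b zero zero = false
adjM₂ M a b zero (suc zero) = false
adjM₂ M a b (suc zero) zero = false
adjM₂ M a b (suc zero) (suc zero) = false
adjM₂ M a b zero (suc (suc v)) = (v == a) ∨ (v == b)
adjM₂ M a b (suc (suc v)) zero = (v == a) ∨ (v == b)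
adjM₂ M a b (suc zero) (suc (suc v)) = (v == a) ∨ (v == b)
adjM₂ M a b (suc (suc v)) (suc zero) = (v == a) ∨ (v == b)
adjM₂ M a b (suc (suc u)) (suc (suc v)) = adj M u v

module Submission where

-- J(M₁;x,y) = J(M₂;x,y) is proved coefficientwise by an explicit involution τ on the subsets
-- W ⊆ V(M) ∪ {c, d} (shared by M₁ and M₂) satisfying |τ W| = |W| and |N_{M₂}(τ W)| = |N_{M₁}(W)|.
--
-- Write W = {c?, d?} ∪ S with S ⊆ V(M).  For both graphs |N(W)| = R_k + |N_M(S) \ {a,b}|, where R_k
-- counts the vertices among c, d, a, b in N_{M_k}(W); R_k depends only on the "profile" of W:
-- c ∈ W, d ∈ W, a ∈ S, b ∈ S and whether a, b have a neighbour in S.  R₁ and R₂ differ only in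
-- two regions: (CB) d, a ∉ W, a dominated by S, exactly one of c, b in W; and symmetrically (DA).
-- τ toggles both c and b in region CB, both d and a in region DA, and is the identity elsewhere;
-- on profiles this turns R₂ into R₁, which is checked by evaluating all 2⁶ profiles.  The graph
-- hypotheses enter only to show that toggling b (while a is dominated by S) does not change
-- N_M(S) \ {a, b}: every neighbour of b is then already in N_M[S] (nbhd-covered).

open import Defs hiding (sym)
open import Data.Nat using (ℕ; zero; suc; _+_; _*_)
import Data.Nat as ℕ
open import Data.Nat.Properties using (+-identityʳ; +-commutativeSemigroup)
open import Algebra.Bundles using (CommutativeMonoid)
open import Algebra.Properties.CommutativeSemigroup +-commutativeSemigroup
  using () renaming (interchange to +-interchange; x∙yz≈y∙xz to +-left-comm)
open import Data.Nat.Tactic.RingSolver using (solve-∀)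
open import Data.Bool using (Bool; true; false; _∧_; _∨_; not; _xor_)
open import Data.Bool.Properties using (∧-comm; ∧-assoc; ∧-distribˡ-∨; ∧-zeroʳ; ∧-identityʳ; ∨-identityʳ; ∨-zeroʳ; not-involutive; ⇔→≡;
  ∨-commutativeMonoid)
import Data.Bool.Properties as Bool
open import Algebra.Properties.CommutativeSemigroup (CommutativeMonoid.commutativeSemigroup ∨-commutativeMonoid)
  using () renaming (interchange to ∨-interchange)
open import Data.Fin using (Fin; zero; suc)
open import Data.Fin.Properties using (_≟_)
open import Data.List using (List; []; _∷_; map; _++_; length; filterᵇ; tabulate)
open import Data.List.Properties using (filter-++; length-++)
open import Data.Bool.ListAction using () renaming (any to anyL)
open import Data.Vec using ([]; _∷_; lookup; updateAt)
open import Data.Vec.Properties using (updateAt-updateAt-local; updateAt-id; lookup∘updateAt; lookup∘updateAt′)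
open import Data.Product using (_×_; _,_; proj₁; proj₂; ∃-syntax)
open import Data.Sum using (_⊎_; inj₁; inj₂) renaming (swap to ⊎-swap)
open import Function using (_∘_; id)
open import Function.Bundles using (mk⇔)
open import Relation.Nullary using (Dec; yes; no)
open import Relation.Nullary.Decidable using (⌊_⌋; isYes≗does; dec-true; dec-false; toWitness; map′)
open import Relation.Binary.PropositionalEquality
  using (_≡_; _≢_; refl; sym; trans; cong; cong₂; module ≡-Reasoning)
open ≡-Reasoning

ι : Bool → ℕ
ι true  = 1
ι false = 0

count : ∀ {n} → (Fin n → Bool) → ℕ
count {zero}  p = 0
count {suc n} p = ι (p zero) + count (p ∘ suc)

anyᶠ : ∀ {n} → (Fin n → Bool) → Bool
anyᶠ {zero}  p = false
anyᶠ {suc n} p = p zero ∨ anyᶠ (p ∘ suc)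

length-filter-tabulate : ∀ {A : Set} {n} (f : Fin n → A) (p : A → Bool) →
  length (filterᵇ p (tabulate f)) ≡ count (p ∘ f)
length-filter-tabulate {n = zero}  f p = refl
length-filter-tabulate {n = suc n} f p with p (f zero)
... | true  = cong suc (length-filter-tabulate (f ∘ suc) p)
... | false = length-filter-tabulate (f ∘ suc) p

countᵇ≡count : ∀ {n} (p : Fin n → Bool) → countᵇ p ≡ count p
countᵇ≡count p = length-filter-tabulate id p

any-tabulate : ∀ {A : Set} {n} (g : Fin n → A) (f : A → Bool) →
  anyL f (tabulate g) ≡ anyᶠ (f ∘ g)
any-tabulate {n = zero}  g f = refl
any-tabulate {n = suc n} g f = cong (f (g zero) ∨_) (any-tabulate (g ∘ suc) f)

count-cong : ∀ {n} {p q : Fin n → Bool} → (∀ x → p x ≡ q x) → count p ≡ count q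
count-cong {zero}  eq = refl
count-cong {suc n} eq = cong₂ _+_ (cong ι (eq zero)) (count-cong (eq ∘ suc))

anyᶠ-cong : ∀ {n} {p q : Fin n → Bool} → (∀ x → p x ≡ q x) → anyᶠ p ≡ anyᶠ q
anyᶠ-cong {zero}  eq = refl
anyᶠ-cong {suc n} eq = cong₂ _∨_ (eq zero) (anyᶠ-cong (eq ∘ suc))

anyᶠ-∨ : ∀ {n} (p q : Fin n → Bool) → anyᶠ (λ x → p x ∨ q x) ≡ anyᶠ p ∨ anyᶠ q
anyᶠ-∨ {zero}  p q = refl
anyᶠ-∨ {suc n} p q = begin
  (p zero ∨ q zero) ∨ anyᶠ (λ x → p (suc x) ∨ q (suc x))
    ≡⟨ cong ((p zero ∨ q zero) ∨_) (anyᶠ-∨ (p ∘ suc) (q ∘ suc)) ⟩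
  (p zero ∨ q zero) ∨ (anyᶠ (p ∘ suc) ∨ anyᶠ (q ∘ suc))
    ≡⟨ ∨-interchange (p zero) (q zero) _ _ ⟩
  (p zero ∨ anyᶠ (p ∘ suc)) ∨ (q zero ∨ anyᶠ (q ∘ suc)) ∎

∧-true : ∀ {x y} → x ∧ y ≡ true → x ≡ true × y ≡ true
∧-true {true} {true} refl = refl , refl

absorb : ∀ t d e → (e ≡ true → t ∨ d ≡ true) → not t ∧ (d ∨ e) ≡ not t ∧ d
absorb t     d     false _ = cong (not t ∧_) (∨-identityʳ d)
absorb true  d     true  _ = refl
absorb false true  true  _ = refl
absorb false false true  h with h refl
... | ()

==-refl : ∀ {n} (u : Fin n) → (u == u) ≡ true
==-refl u = trans (isYes≗does (u ≟ u)) (dec-true (u ≟ u) refl)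

==-no : ∀ {n} {u v : Fin n} → u ≢ v → (u == v) ≡ false
==-no {u = u} {v} u≢v = trans (isYes≗does (u ≟ v)) (dec-false (u ≟ v) u≢v)

==-suc : ∀ {n} (u v : Fin n) → (suc u == suc v) ≡ (u == v)
==-suc u v = trans (isYes≗does (suc u ≟ suc v)) (sym (isYes≗does (u ≟ v)))

anyᶠ-at : ∀ {n} (q : Fin n) (p : Fin n → Bool) → anyᶠ (λ u → (u == q) ∧ p u) ≡ p q
anyᶠ-at {suc n} zero p = trans (cong (p zero ∨_) (none {n})) (∨-identityʳ (p zero))
  where
  none : ∀ {m} → anyᶠ {m} (λ _ → false) ≡ false
  none {zero}  = refl
  none {suc m} = none {m}
anyᶠ-at {suc n} (suc q) p =
  trans (anyᶠ-cong (λ u → cong (_∧ p (suc u)) (==-suc u q))) (anyᶠ-at q (p ∘ suc))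

anyᶠ-member : ∀ {n} (q : Fin n) (p : Fin n → Bool) → anyᶠ (λ u → p u ∧ (u == q)) ≡ p q
anyᶠ-member q p = trans (anyᶠ-cong (λ u → ∧-comm (p u) (u == q))) (anyᶠ-at q p)

anyᶠ-select : ∀ {n} (q : Fin n) (f : Fin n → Bool) (t : Bool) →
  anyᶠ (λ u → f u ∧ ((u == q) ∧ t)) ≡ f q ∧ t
anyᶠ-select q f t = trans (anyᶠ-cong reorder) (anyᶠ-at q (λ u → f u ∧ t))
  where
  reorder : ∀ u → f u ∧ ((u == q) ∧ t) ≡ (u == q) ∧ (f u ∧ t)
  reorder u = begin
    f u ∧ ((u == q) ∧ t)   ≡⟨ sym (∧-assoc (f u) (u == q) t) ⟩
    (f u ∧ (u == q)) ∧ t   ≡⟨ cong (_∧ t) (∧-comm (f u) (u == q)) ⟩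
    ((u == q) ∧ f u) ∧ t   ≡⟨ ∧-assoc (u == q) (f u) t ⟩
    (u == q) ∧ (f u ∧ t)   ∎

-- Domination after adding the edges {i, y} (if s) and {j, y} (if t) to the edges g of a
-- fixed vertex y: the members f of the dominating set contribute through i and j.
anyᶠ-extra-edges : ∀ {n} (f g : Fin n → Bool) (i j : Fin n) (s t : Bool) →
  anyᶠ (λ u → f u ∧ (g u ∨ (((u == i) ∧ s) ∨ ((u == j) ∧ t))))
    ≡ anyᶠ (λ u → f u ∧ g u) ∨ ((f i ∧ s) ∨ (f j ∧ t))
anyᶠ-extra-edges f g i j s t = begin
  anyᶠ (λ u → f u ∧ (g u ∨ (((u == i) ∧ s) ∨ ((u == j) ∧ t))))
    ≡⟨ anyᶠ-cong distribute ⟩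
  anyᶠ (λ u → (f u ∧ g u) ∨ ((f u ∧ ((u == i) ∧ s)) ∨ (f u ∧ ((u == j) ∧ t))))
    ≡⟨ anyᶠ-∨ (λ u → f u ∧ g u) _ ⟩
  anyᶠ (λ u → f u ∧ g u) ∨ anyᶠ (λ u → (f u ∧ ((u == i) ∧ s)) ∨ (f u ∧ ((u == j) ∧ t)))
    ≡⟨ cong (anyᶠ (λ u → f u ∧ g u) ∨_) (anyᶠ-∨ (λ u → f u ∧ ((u == i) ∧ s)) (λ u → f u ∧ ((u == j) ∧ t))) ⟩
  anyᶠ (λ u → f u ∧ g u) ∨ (anyᶠ (λ u → f u ∧ ((u == i) ∧ s)) ∨ anyᶠ (λ u → f u ∧ ((u == j) ∧ t)))
    ≡⟨ cong₂ (λ x y → anyᶠ (λ u → f u ∧ g u) ∨ (x ∨ y)) (anyᶠ-select i f s) (anyᶠ-select j f t) ⟩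
  anyᶠ (λ u → f u ∧ g u) ∨ ((f i ∧ s) ∨ (f j ∧ t)) ∎
  where
  distribute : ∀ u → f u ∧ (g u ∨ (((u == i) ∧ s) ∨ ((u == j) ∧ t)))
                   ≡ (f u ∧ g u) ∨ ((f u ∧ ((u == i) ∧ s)) ∨ (f u ∧ ((u == j) ∧ t)))
  distribute u = trans (∧-distribˡ-∨ (f u) (g u) _) (cong ((f u ∧ g u) ∨_) (∧-distribˡ-∨ (f u) _ _))

anyᶠ-witness : ∀ {n} (p : Fin n → Bool) → anyᶠ p ≡ true → ∃[ s ] p s ≡ true
anyᶠ-witness {suc n} p h with p zero in eq
... | true  = zero , eq
... | false = let s , ps = anyᶠ-witness (p ∘ suc) h in suc s , ps

anyᶠ-intro : ∀ {n} (p : Fin n → Bool) (s : Fin n) → p s ≡ true → anyᶠ p ≡ true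
anyᶠ-intro {suc n} p zero    ps rewrite ps = refl
anyᶠ-intro {suc n} p (suc s) ps rewrite anyᶠ-intro (p ∘ suc) s ps = ∨-zeroʳ (p zero)

away : ∀ {n} → Fin n → (Fin n → Bool) → Fin n → Bool
away q p x = not (x == q) ∧ p x

count-away : ∀ {n} (q : Fin n) (p : Fin n → Bool) → count p ≡ ι (p q) + count (away q p)
count-away {suc n} zero    p = refl
count-away {suc n} (suc q) p = begin
  ι (p zero) + count (p ∘ suc)
    ≡⟨ cong (ι (p zero) +_) (count-away q (p ∘ suc)) ⟩
  ι (p zero) + (ι (p (suc q)) + count (away q (p ∘ suc)))
    ≡⟨ +-left-comm (ι (p zero)) (ι (p (suc q))) (count (away q (p ∘ suc))) ⟩
  ι (p (suc q)) + (ι (p zero) + count (away q (p ∘ suc)))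
    ≡⟨ cong (λ m → ι (p (suc q)) + (ι (p zero) + m))
         (count-cong (λ x → cong (λ e → not e ∧ p (suc x)) (sym (==-suc x q)))) ⟩
  ι (p (suc q)) + count (away (suc q) p) ∎

away-cong : ∀ {n} (q : Fin n) {p p′ : Fin n → Bool} → (∀ x → x ≢ q → p x ≡ p′ x) →
  ∀ x → away q p x ≡ away q p′ x
away-cong q eq x with x ≟ q
... | yes _   = refl
... | no  x≢q = eq x x≢q

count-away₂ : ∀ {n} (i j : Fin n) → j ≢ i → (p : Fin n → Bool) →
  count p ≡ ι (p i) + (ι (p j) + count (away j (away i p)))
count-away₂ i j j≢i p = begin
  count p                                             ≡⟨ count-away i p ⟩
  ι (p i) + count (away i p)                          ≡⟨ cong (ι (p i) +_) (count-away j (away i p)) ⟩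
  ι (p i) + (ι (away i p j) + count (away j (away i p)))
    ≡⟨ cong (λ e → ι (p i) + (ι (not e ∧ p j) + count (away j (away i p)))) (==-no j≢i) ⟩
  ι (p i) + (ι (p j) + count (away j (away i p))) ∎

away₂-cong : ∀ {n} (i j : Fin n) {p p′ : Fin n → Bool} → (∀ x → x ≢ i → x ≢ j → p x ≡ p′ x) →
  ∀ x → away j (away i p) x ≡ away j (away i p′) x
away₂-cong i j eq x with x ≟ j | x ≟ i
... | yes _   | _       = refl
... | no  _   | yes _   = refl
... | no  x≢j | no  x≢i = eq x x≢i x≢j

nbhdCard-count : ∀ {n} (adj′ : Fin n → Fin n → Bool) (W : Subset n) →
  nbhdCard adj′ W ≡ count (λ v → not (lookup W v) ∧ anyᶠ (λ w → lookup W w ∧ adj′ w v))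
nbhdCard-count adj′ W = trans (countᵇ≡count (inOpenNbhd adj′ W))
  (count-cong (λ v → cong (not (lookup W v) ∧_) (any-tabulate id (λ w → lookup W w ∧ adj′ w v))))

regroup : ∀ {u v w z u′ v′ w′ z′ : Bool} {m m′ : ℕ} →
  u ≡ u′ → v ≡ v′ → w ≡ w′ → z ≡ z′ → m ≡ m′ →
  ι u + (ι v + (ι w + (ι z + m))) ≡ (ι u′ + (ι v′ + (ι w′ + ι z′))) + m′
regroup {u′ = u′} {v′} {w′} {z′} {m′ = m′} refl refl refl refl refl = reassociate (ι u′) (ι v′) (ι w′) (ι z′) m′
  where
  reassociate : ∀ x y z w m → x + (y + (z + (w + m))) ≡ (x + (y + (z + w))) + m
  reassociate = solve-∀

sumₛ : ∀ {n} → (Subset n → ℕ) → ℕ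
sumₛ {zero}  f = f []
sumₛ {suc n} f = sumₛ (f ∘ (true ∷_)) + sumₛ (f ∘ (false ∷_))

length-filter-map : ∀ {A B : Set} (p : B → Bool) (f : A → B) (xs : List A) →
  length (filterᵇ p (map f xs)) ≡ length (filterᵇ (p ∘ f) xs)
length-filter-map p f []       = refl
length-filter-map p f (x ∷ xs) with p (f x)
... | true  = cong suc (length-filter-map p f xs)
... | false = length-filter-map p f xs

length-filter-subsets : ∀ n (p : Subset n → Bool) →
  length (filterᵇ p (subsets n)) ≡ sumₛ (ι ∘ p)
length-filter-subsets zero    p with p []
... | true  = refl
... | false = refl
length-filter-subsets (suc n) p = begin
  length (filterᵇ p (map (true ∷_) (subsets n) ++ map (false ∷_) (subsets n)))
    ≡⟨ cong length (filter-++ _ (map (true ∷_) (subsets n)) (map (false ∷_) (subsets n))) ⟩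
  length (filterᵇ p (map (true ∷_) (subsets n)) ++ filterᵇ p (map (false ∷_) (subsets n)))
    ≡⟨ length-++ (filterᵇ p (map (true ∷_) (subsets n))) ⟩
  length (filterᵇ p (map (true ∷_) (subsets n))) + length (filterᵇ p (map (false ∷_) (subsets n)))
    ≡⟨ cong₂ _+_ (half true) (half false) ⟩
  sumₛ (ι ∘ p) ∎
  where
  half : ∀ x → length (filterᵇ p (map (x ∷_) (subsets n))) ≡ sumₛ (ι ∘ p ∘ (x ∷_))
  half x = trans (length-filter-map p (x ∷_) (subsets n)) (length-filter-subsets n (p ∘ (x ∷_)))

sumₛ-cong : ∀ {n} {f g : Subset n → ℕ} → (∀ U → f U ≡ g U) → sumₛ f ≡ sumₛ g
sumₛ-cong {zero}  eq = eq []
sumₛ-cong {suc n} eq = cong₂ _+_ (sumₛ-cong (eq ∘ (true ∷_))) (sumₛ-cong (eq ∘ (false ∷_)))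

sumₛ-+ : ∀ {n} (f g : Subset n → ℕ) → sumₛ (λ U → f U + g U) ≡ sumₛ f + sumₛ g
sumₛ-+ {zero}  f g = refl
sumₛ-+ {suc n} f g = begin
  sumₛ (λ U → f (true ∷ U) + g (true ∷ U)) + sumₛ (λ U → f (false ∷ U) + g (false ∷ U))
    ≡⟨ cong₂ _+_ (sumₛ-+ (f ∘ (true ∷_)) (g ∘ (true ∷_))) (sumₛ-+ (f ∘ (false ∷_)) (g ∘ (false ∷_))) ⟩
  (sumₛ (f ∘ (true ∷_)) + sumₛ (g ∘ (true ∷_))) + (sumₛ (f ∘ (false ∷_)) + sumₛ (g ∘ (false ∷_)))
    ≡⟨ +-interchange (sumₛ (f ∘ (true ∷_))) (sumₛ (g ∘ (true ∷_))) (sumₛ (f ∘ (false ∷_))) (sumₛ (g ∘ (false ∷_))) ⟩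
  sumₛ f + sumₛ g ∎

sumₛ-comm : ∀ {m n} (f : Subset m → Subset n → ℕ) →
  sumₛ (λ U → sumₛ (λ V → f U V)) ≡ sumₛ (λ V → sumₛ (λ U → f U V))
sumₛ-comm {zero}  f = refl
sumₛ-comm {suc m} f = begin
  sumₛ (λ U → sumₛ (f (true ∷ U))) + sumₛ (λ U → sumₛ (f (false ∷ U)))
    ≡⟨ cong₂ _+_ (sumₛ-comm (f ∘ (true ∷_))) (sumₛ-comm (f ∘ (false ∷_))) ⟩
  sumₛ (λ V → sumₛ (λ U → f (true ∷ U) V)) + sumₛ (λ V → sumₛ (λ U → f (false ∷ U) V))
    ≡⟨ sym (sumₛ-+ (λ V → sumₛ (λ U → f (true ∷ U) V)) (λ V → sumₛ (λ U → f (false ∷ U) V))) ⟩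
  sumₛ (λ V → sumₛ (λ U → f U V)) ∎

_≐_ : ∀ {n} → Subset n → Subset n → Bool
[]          ≐ []          = true
(true ∷ U)  ≐ (true ∷ V)  = U ≐ V
(false ∷ U) ≐ (false ∷ V) = U ≐ V
(true ∷ U)  ≐ (false ∷ V) = false
(false ∷ U) ≐ (true ∷ V)  = false

≐-complete : ∀ {n} {U V : Subset n} → U ≡ V → (U ≐ V) ≡ true
≐-complete {U = []}        refl = refl
≐-complete {U = true ∷ U}  refl = ≐-complete {U = U} refl
≐-complete {U = false ∷ U} refl = ≐-complete {U = U} refl

≐-sound : ∀ {n} (U V : Subset n) → (U ≐ V) ≡ true → U ≡ V
≐-sound []          []          e = refl
≐-sound (true ∷ U)  (true ∷ V)  e = cong (true ∷_) (≐-sound U V e)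
≐-sound (false ∷ U) (false ∷ V) e = cong (false ∷_) (≐-sound U V e)

sumₛ-zero : ∀ {n} → sumₛ {n} (λ _ → 0) ≡ 0
sumₛ-zero {zero}  = refl
sumₛ-zero {suc n} = cong₂ _+_ (sumₛ-zero {n}) (sumₛ-zero {n})

sumₛ-point : ∀ {n} (U : Subset n) (f : Subset n → ℕ) → sumₛ (λ V → ι (U ≐ V) * f V) ≡ f U
sumₛ-point []          f = +-identityʳ (f [])
sumₛ-point {suc n} (true ∷ U)  f =
  trans (cong (sumₛ (λ V → ι (U ≐ V) * f (true ∷ V)) +_) (sumₛ-zero {n}))
        (trans (+-identityʳ _) (sumₛ-point U (f ∘ (true ∷_))))
sumₛ-point {suc n} (false ∷ U) f =
  trans (cong (_+ sumₛ (λ V → ι (U ≐ V) * f (false ∷ V))) (sumₛ-zero {n})) (sumₛ-point U (f ∘ (false ∷_)))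

sumₛ-involution : ∀ {n} (σ : Subset n → Subset n) → (∀ U → σ (σ U) ≡ U) →
  (f : Subset n → ℕ) → sumₛ (f ∘ σ) ≡ sumₛ f
sumₛ-involution σ σσ f = begin
  sumₛ (f ∘ σ)                                         ≡⟨ sumₛ-cong (λ U → sym (sumₛ-point (σ U) f)) ⟩
  sumₛ (λ U → sumₛ (λ V → ι (σ U ≐ V) * f V))          ≡⟨ sumₛ-comm (λ U V → ι (σ U ≐ V) * f V) ⟩
  sumₛ (λ V → sumₛ (λ U → ι (σ U ≐ V) * f V))
    ≡⟨ sumₛ-cong (λ V → sumₛ-cong (λ U → cong (λ e → ι e * f V) (transpose U V))) ⟩
  sumₛ (λ V → sumₛ (λ U → ι (σ V ≐ U) * f V))          ≡⟨ sumₛ-cong (λ V → sumₛ-point (σ V) (λ _ → f V)) ⟩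
  sumₛ f ∎
  where
  flipped : ∀ U V → (σ U ≐ V) ≡ true → (σ V ≐ U) ≡ true
  flipped U V e = ≐-complete (trans (cong σ (sym (≐-sound (σ U) V e))) (σσ U))
  transpose : ∀ U V → (σ U ≐ V) ≡ (σ V ≐ U)
  transpose U V = ⇔→≡ (mk⇔ (flipped U V) (flipped V U))

toggle : ∀ {n} → Fin n → Subset n → Subset n
toggle q S = updateAt S q not

lookup-toggle-self : ∀ {n} (q : Fin n) (S : Subset n) → lookup (toggle q S) q ≡ not (lookup S q)
lookup-toggle-self q S = lookup∘updateAt q S

lookup-toggle-other : ∀ {n} (q x : Fin n) (S : Subset n) → x ≢ q → lookup (toggle q S) x ≡ lookup S x
lookup-toggle-other q x S x≢q = lookup∘updateAt′ x q x≢q S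

toggle-involutive : ∀ {n} (q : Fin n) (S : Subset n) → toggle q (toggle q S) ≡ S
toggle-involutive q S =
  trans (updateAt-updateAt-local q S (not-involutive (lookup S q))) (updateAt-id q S)

card-toggle : ∀ {n} (q : Fin n) (S : Subset n) →
  ι (lookup S q) + count (lookup (toggle q S)) ≡ ι (not (lookup S q)) + count (lookup S)
card-toggle q S = begin
  ι (lookup S q) + count (lookup (toggle q S))
    ≡⟨ cong (ι (lookup S q) +_) (count-away q (lookup (toggle q S))) ⟩
  ι (lookup S q) + (ι (lookup (toggle q S) q) + count (away q (lookup (toggle q S))))
    ≡⟨ cong₂ (λ e m → ι (lookup S q) + (ι e + m)) (lookup-toggle-self q S)
         (count-cong (away-cong q (λ x → lookup-toggle-other q x S))) ⟩
  ι (lookup S q) + (ι (not (lookup S q)) + count (away q (lookup S)))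
    ≡⟨ +-left-comm (ι (lookup S q)) (ι (not (lookup S q))) (count (away q (lookup S))) ⟩
  ι (not (lookup S q)) + (ι (lookup S q) + count (away q (lookup S)))
    ≡⟨ cong (ι (not (lookup S q)) +_) (sym (count-away q (lookup S))) ⟩
  ι (not (lookup S q)) + count (lookup S) ∎

card-pair : ∀ {n} (q : Fin n) (S : Subset n) {c : Bool} → c ≡ not (lookup S q) →
  ι (not c) + count (lookup (toggle q S)) ≡ ι c + count (lookup S)
card-pair q S refl =
  trans (cong (λ e → ι e + count (lookup (toggle q S))) (not-involutive (lookup S q))) (card-toggle q S)

module Domination {n : ℕ} (M : SimpleGraph n) where

  A : Fin n → Fin n → Bool
  A = adj M

  dominated : Subset n → Fin n → Bool
  dominated S x = anyᶠ (λ u → lookup S u ∧ A u x)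

  inNbhd : Subset n → Fin n → Bool
  inNbhd S x = not (lookup S x) ∧ dominated S x

  dominated-toggle-nonadj : ∀ q x S → A q x ≡ false → dominated (toggle q S) x ≡ dominated S x
  dominated-toggle-nonadj q x S qx = anyᶠ-cong same
    where
    same : ∀ u → lookup (toggle q S) u ∧ A u x ≡ lookup S u ∧ A u x
    same u with u ≟ q
    ... | yes refl rewrite qx = trans (∧-zeroʳ _) (sym (∧-zeroʳ _))
    ... | no  u≢q  = cong (_∧ A u x) (lookup-toggle-other q u S u≢q)

  dominated-add : ∀ q x S → lookup S q ≡ false → dominated (toggle q S) x ≡ dominated S x ∨ A q x
  dominated-add q x S q∉S = begin
    anyᶠ (λ u → lookup (toggle q S) u ∧ A u x)
      ≡⟨ anyᶠ-cong split ⟩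
    anyᶠ (λ u → (lookup S u ∧ A u x) ∨ ((u == q) ∧ A u x))
      ≡⟨ anyᶠ-∨ (λ u → lookup S u ∧ A u x) (λ u → (u == q) ∧ A u x) ⟩
    dominated S x ∨ anyᶠ (λ u → (u == q) ∧ A u x)
      ≡⟨ cong (dominated S x ∨_) (anyᶠ-at q (λ u → A u x)) ⟩
    dominated S x ∨ A q x ∎
    where
    split : ∀ u → lookup (toggle q S) u ∧ A u x ≡ (lookup S u ∧ A u x) ∨ ((u == q) ∧ A u x)
    split u with u ≟ q
    ... | yes refl rewrite lookup-toggle-self u S | q∉S = refl
    ... | no  u≢q  = trans (cong (_∧ A u x) (lookup-toggle-other q u S u≢q)) (sym (∨-identityʳ _))

  CommonUniversal : Fin n → Fin n → Set
  CommonUniversal p q = ∀ v → A p v ≡ true → A q v ≡ true → ∀ u → u ≢ v → A v u ≡ true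

  PrivateComplete : Fin n → Fin n → Set
  PrivateComplete p q = ∀ u v → A p u ≡ true → A q u ≡ false → A q v ≡ true → A u v ≡ true

  CommonUniversal-sym : ∀ {p q} → CommonUniversal p q → CommonUniversal q p
  CommonUniversal-sym common v qv pv = common v pv qv

  neighbours-linked : ∀ {p q} → CommonUniversal p q → PrivateComplete p q ⊎ PrivateComplete q p →
    ∀ s x → A p s ≡ true → A q x ≡ true → s ≡ x ⊎ A s x ≡ true
  neighbours-linked {p} {q} common complete s x ps qx with s ≟ x
  ... | yes s≡x = inj₁ s≡x
  ... | no  s≢x with A q s in qs
  ... | true  = inj₂ (common s ps qs x (s≢x ∘ sym))
  ... | false with complete
  ... | inj₁ p-private = inj₂ (p-private s x ps qs qx)
  ... | inj₂ q-private with A p x in px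
  ... | true  = inj₂ (trans (SimpleGraph.sym M s x) (common x px qx s s≢x))
  ... | false = inj₂ (trans (SimpleGraph.sym M s x) (q-private x s qx px ps))

  nbhd-covered : ∀ {p q} → CommonUniversal p q → PrivateComplete p q ⊎ PrivateComplete q p →
    ∀ S → dominated S p ≡ true → ∀ x → A q x ≡ true → lookup S x ∨ dominated S x ≡ true
  nbhd-covered {p} common complete S Sp x qx with anyᶠ-witness (λ u → lookup S u ∧ A u p) Sp
  ... | s , s-dominates with ∧-true {lookup S s} s-dominates
  ... | s∈S , sp with neighbours-linked common complete s x (trans (SimpleGraph.sym M p s) sp) qx
  ... | inj₁ refl = cong (_∨ dominated S s) s∈S
  ... | inj₂ sx   =
    trans (cong (lookup S x ∨_) (anyᶠ-intro (λ u → lookup S u ∧ A u x) s (cong₂ _∧_ s∈S sx)))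
          (∨-zeroʳ (lookup S x))

  -- If p has a neighbour in S, adding a vertex q ∉ S to S changes membership in N(S)
  -- of no vertex other than q: the neighbours of q already lie in N[S].
  inNbhd-add : ∀ {p q} → CommonUniversal p q → PrivateComplete p q ⊎ PrivateComplete q p →
    ∀ S → lookup S q ≡ false → dominated S p ≡ true → ∀ x → x ≢ q → inNbhd (toggle q S) x ≡ inNbhd S x
  inNbhd-add {p} {q} common complete S q∉S Sp x x≢q = begin
    not (lookup (toggle q S) x) ∧ dominated (toggle q S) x
      ≡⟨ cong₂ (λ t e → not t ∧ e) (lookup-toggle-other q x S x≢q) (dominated-add q x S q∉S) ⟩
    not (lookup S x) ∧ (dominated S x ∨ A q x)
      ≡⟨ absorb (lookup S x) (dominated S x) (A q x) (nbhd-covered common complete S Sp x) ⟩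
    inNbhd S x ∎

  inNbhd-toggle : ∀ {p q} → CommonUniversal p q → PrivateComplete p q ⊎ PrivateComplete q p →
    A q p ≡ false → ∀ S → dominated S p ≡ true → ∀ x → x ≢ q → inNbhd (toggle q S) x ≡ inNbhd S x
  inNbhd-toggle {p} {q} common complete q≁p S Sp x x≢q with lookup S q in q∈S
  ... | false = inNbhd-add common complete S q∈S Sp x x≢q
  ... | true  = begin
    inNbhd S′ x              ≡⟨ sym (inNbhd-add common complete S′ q∉S′ p-dominated x x≢q) ⟩
    inNbhd (toggle q S′) x   ≡⟨ cong (λ U → inNbhd U x) (toggle-involutive q S) ⟩
    inNbhd S x ∎
    where
    S′ : Subset n
    S′ = toggle q S
    q∉S′ : lookup S′ q ≡ false
    q∉S′ = trans (lookup-toggle-self q S) (cong not q∈S)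
    p-dominated : dominated S′ p ≡ true
    p-dominated = trans (dominated-toggle-nonadj q p S q≁p) Sp

-- The profile of W = c∷d∷S relative to a, b records: c ∈ W, d ∈ W, a ∈ S, b ∈ S,
-- a dominated by S, b dominated by S.  It determines how the two extensions differ.
data Profile : Set where
  ⟨_,_,_,_,_,_⟩ : (c d sa sb da db : Bool) → Profile

⟨⟩-cong : ∀ {c d sa sb da db sa′ sb′ da′ db′} →
  sa ≡ sa′ → sb ≡ sb′ → da ≡ da′ → db ≡ db′ → ⟨ c , d , sa , sb , da , db ⟩ ≡ ⟨ c , d , sa′ , sb′ , da′ , db′ ⟩
⟨⟩-cong refl refl refl refl = refl

-- How many of c, d, a, b lie in N_{M₁}(W), resp. N_{M₂}(W).
R₁ R₂ : Profile → ℕ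
R₁ ⟨ c , d , sa , sb , da , db ⟩ =
  ι (not c ∧ (d ∨ sb)) + (ι (not d ∧ (c ∨ sa)) + (ι (not sa ∧ (d ∨ (da ∨ sb))) + ι (not sb ∧ (c ∨ (db ∨ sa)))))
R₂ ⟨ c , d , sa , sb , da , db ⟩ =
  ι (not c ∧ (sa ∨ sb)) + (ι (not d ∧ (sa ∨ sb)) + (ι (not sa ∧ (c ∨ (d ∨ da))) + ι (not sb ∧ (c ∨ (d ∨ db)))))

-- The two regions where R₁ and R₂ may differ: d, a ∉ W, a dominated, and exactly one of
-- c, b in W; symmetrically c, b ∉ W, b dominated, and exactly one of d, a in W.
inCB inDA : Profile → Bool
inCB ⟨ c , d , sa , sb , da , db ⟩ = not d ∧ (not sa ∧ (da ∧ (c xor sb)))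
inDA ⟨ c , d , sa , sb , da , db ⟩ = not c ∧ (not sb ∧ (db ∧ (d xor sa)))

xor-true : ∀ x y → x xor y ≡ true → x ≡ not y
xor-true true  y     h = sym h
xor-true false true  h = refl

inCB-sound : ∀ {c d sa sb da db} → inCB ⟨ c , d , sa , sb , da , db ⟩ ≡ true → da ≡ true × c ≡ not sb
inCB-sound {d = true} ()
inCB-sound {d = false} {sa = true} ()
inCB-sound {d = false} {sa = false} {da = false} ()
inCB-sound {c} {false} {false} {sb} {true} h = refl , xor-true c sb h

inDA-sound : ∀ {c d sa sb da db} → inDA ⟨ c , d , sa , sb , da , db ⟩ ≡ true → db ≡ true × d ≡ not sa
inDA-sound {c = true} ()
inDA-sound {c = false} {sb = true} ()
inDA-sound {c = false} {sb = false} {db = false} ()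
inDA-sound {false} {d} {sa} {false} {db = true} h = refl , xor-true d sa h

exchangeᵖ : Bool → Bool → Profile → Profile
exchangeᵖ true  _     ⟨ c , d , sa , sb , da , db ⟩ = ⟨ not c , d , sa , not sb , da , db ⟩
exchangeᵖ false true  ⟨ c , d , sa , sb , da , db ⟩ = ⟨ c , not d , not sa , sb , da , db ⟩
exchangeᵖ false false p = p

τᵖ : Profile → Profile
τᵖ p = exchangeᵖ (inCB p) (inDA p) p

∀-Bool? : {P : Bool → Set} → (∀ x → Dec (P x)) → Dec (∀ x → P x)
∀-Bool? P? with P? true | P? false
... | yes pt  | yes pf  = yes λ { true → pt ; false → pf }
... | no ¬pt  | _       = no λ h → ¬pt (h true)
... | yes _   | no ¬pf  = no λ h → ¬pf (h false)

∀-Profile? : {P : Profile → Set} → (∀ p → Dec (P p)) → Dec (∀ p → P p)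
∀-Profile? P? = map′ (λ h → λ { ⟨ c , d , sa , sb , da , db ⟩ → h c d sa sb da db })
                     (λ h c d sa sb da db → h ⟨ c , d , sa , sb , da , db ⟩)
  (∀-Bool? λ c → ∀-Bool? λ d → ∀-Bool? λ sa → ∀-Bool? λ sb → ∀-Bool? λ da → ∀-Bool? λ db →
     P? ⟨ c , d , sa , sb , da , db ⟩)

inCB-τᵖ : ∀ p → inCB (τᵖ p) ≡ inCB p
inCB-τᵖ = toWitness {a? = ∀-Profile? (λ p → inCB (τᵖ p) Bool.≟ inCB p)} _

inDA-τᵖ : ∀ p → inDA (τᵖ p) ≡ inDA p
inDA-τᵖ = toWitness {a? = ∀-Profile? (λ p → inDA (τᵖ p) Bool.≟ inDA p)} _

R-exchange : ∀ p → R₂ (τᵖ p) ≡ R₁ p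
R-exchange = toWitness {a? = ∀-Profile? (λ p → R₂ (τᵖ p) ℕ.≟ R₁ p)} _

-- Contribution of an old vertex x to |N(c∷d∷S)| in M₁ and in M₂, in terms of
-- s = [x ∈ S], δ = [x dominated in M], and the tests ea = [x = a], eb = [x = b].
vertex₁ : (c d sa sb s δ ea eb : Bool) → Bool
vertex₁ c d sa sb s δ ea eb = not s ∧ ((c ∧ eb) ∨ ((d ∧ ea) ∨ (δ ∨ ((sa ∧ eb) ∨ (sb ∧ ea)))))

vertex₂ : (c d s δ ea eb : Bool) → Bool
vertex₂ c d s δ ea eb = not s ∧ ((c ∧ (ea ∨ eb)) ∨ ((d ∧ (ea ∨ eb)) ∨ δ))

vertex₁-a : ∀ c d sa sb s δ → vertex₁ c d sa sb s δ true false ≡ not s ∧ (d ∨ (δ ∨ sb))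
vertex₁-a c d sa sb s δ rewrite ∧-zeroʳ c | ∧-identityʳ d | ∧-zeroʳ sa | ∧-identityʳ sb = refl

vertex₁-b : ∀ c d sa sb s δ → vertex₁ c d sa sb s δ false true ≡ not s ∧ (c ∨ (δ ∨ sa))
vertex₁-b c d sa sb s δ
  rewrite ∧-identityʳ c | ∧-zeroʳ d | ∧-identityʳ sa | ∧-zeroʳ sb | ∨-identityʳ sa = refl

vertex₁-off : ∀ c d sa sb s δ → vertex₁ c d sa sb s δ false false ≡ not s ∧ δ
vertex₁-off c d sa sb s δ
  rewrite ∧-zeroʳ c | ∧-zeroʳ d | ∧-zeroʳ sa | ∧-zeroʳ sb | ∨-identityʳ δ = refl

vertex₂-on : ∀ c d s δ ea eb → ea ∨ eb ≡ true → vertex₂ c d s δ ea eb ≡ not s ∧ (c ∨ (d ∨ δ))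
vertex₂-on c d s δ ea eb e rewrite e | ∧-identityʳ c | ∧-identityʳ d = refl

vertex₂-off : ∀ c d s δ → vertex₂ c d s δ false false ≡ not s ∧ δ
vertex₂-off c d s δ rewrite ∧-zeroʳ c | ∧-zeroʳ d = refl

module Extensions {n : ℕ} (M : SimpleGraph n) (a b : Fin n) (a≢b : a ≢ b) (a≁b : adj M a b ≡ false) where
  open Domination M

  b≢a : b ≢ a
  b≢a = a≢b ∘ sym

  b≁a : A b a ≡ false
  b≁a = trans (SimpleGraph.sym M b a) a≁b

  body : Subset (suc (suc n)) → Subset n
  body (_ ∷ _ ∷ S) = S

  profile : Subset (suc (suc n)) → Profile
  profile (c ∷ d ∷ S) = ⟨ c , d , lookup S a , lookup S b , dominated S a , dominated S b ⟩

  -- |N_M(S) \ {a, b}|: the part of the neighbourhood common to both extensions.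
  outside : Subset n → ℕ
  outside S = count (away b (away a (inNbhd S)))

  inNbhdOf : (Fin (suc (suc n)) → Fin (suc (suc n)) → Bool) → Subset (suc (suc n)) → Fin (suc (suc n)) → Bool
  inNbhdOf H W v = not (lookup W v) ∧ anyᶠ (λ w → lookup W w ∧ H w v)

  nbhd-split : ∀ H c d S → nbhdCard H (c ∷ d ∷ S) ≡
    ι (inNbhdOf H (c ∷ d ∷ S) zero) + (ι (inNbhdOf H (c ∷ d ∷ S) (suc zero)) +
      (ι (inNbhdOf H (c ∷ d ∷ S) (suc (suc a))) + (ι (inNbhdOf H (c ∷ d ∷ S) (suc (suc b))) +
        count (away b (away a (λ x → inNbhdOf H (c ∷ d ∷ S) (suc (suc x))))))))
  nbhd-split H c d S = trans (nbhdCard-count H (c ∷ d ∷ S))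
    (cong (λ m → ι (inNbhdOf H (c ∷ d ∷ S) zero) + (ι (inNbhdOf H (c ∷ d ∷ S) (suc zero)) + m))
          (count-away₂ a b b≢a (λ x → inNbhdOf H (c ∷ d ∷ S) (suc (suc x)))))

  -- In M₁, c is adjacent to d and b, d to c and a, and the new edge ab lets a ∈ S
  -- dominate b and b ∈ S dominate a; all other vertices behave as in M.
  nbhd₁-formula : ∀ W → nbhdCard (adjM₁ M a b) W ≡ R₁ (profile W) + outside (body W)
  nbhd₁-formula (c ∷ d ∷ S) =
    trans (nbhd-split (adjM₁ M a b) c d S) (regroup at-c at-d at-a at-b (count-cong (away₂-cong a b rest)))
    where
    sa sb : Bool
    sa = lookup S a
    sb = lookup S b
    old : ∀ x → inNbhdOf (adjM₁ M a b) (c ∷ d ∷ S) (suc (suc x))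
              ≡ vertex₁ c d sa sb (lookup S x) (dominated S x) (x == a) (x == b)
    old x = cong (λ e → not (lookup S x) ∧ ((c ∧ (x == b)) ∨ ((d ∧ (x == a)) ∨ e)))
                 (anyᶠ-extra-edges (lookup S) (λ u → A u x) a b (x == b) (x == a))
    at-c : not c ∧ ((c ∧ false) ∨ ((d ∧ true) ∨ anyᶠ (λ u → lookup S u ∧ (u == b)))) ≡ not c ∧ (d ∨ sb)
    at-c = cong₂ (λ x y → not c ∧ (x ∨ y)) (∧-zeroʳ c) (cong₂ _∨_ (∧-identityʳ d) (anyᶠ-member b (lookup S)))
    at-d : not d ∧ ((c ∧ true) ∨ ((d ∧ false) ∨ anyᶠ (λ u → lookup S u ∧ (u == a)))) ≡ not d ∧ (c ∨ sa)
    at-d = cong₂ (λ x y → not d ∧ (x ∨ y)) (∧-identityʳ c) (cong₂ _∨_ (∧-zeroʳ d) (anyᶠ-member a (lookup S)))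
    at-a : inNbhdOf (adjM₁ M a b) (c ∷ d ∷ S) (suc (suc a)) ≡ not sa ∧ (d ∨ (dominated S a ∨ sb))
    at-a = trans (old a) (trans (cong₂ (vertex₁ c d sa sb sa (dominated S a)) (==-refl a) (==-no a≢b))
                                (vertex₁-a c d sa sb sa (dominated S a)))
    at-b : inNbhdOf (adjM₁ M a b) (c ∷ d ∷ S) (suc (suc b)) ≡ not sb ∧ (c ∨ (dominated S b ∨ sa))
    at-b = trans (old b) (trans (cong₂ (vertex₁ c d sa sb sb (dominated S b)) (==-no b≢a) (==-refl b))
                                (vertex₁-b c d sa sb sb (dominated S b)))
    rest : ∀ x → x ≢ a → x ≢ b → inNbhdOf (adjM₁ M a b) (c ∷ d ∷ S) (suc (suc x)) ≡ inNbhd S x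
    rest x x≢a x≢b = trans (old x) (trans (cong₂ (vertex₁ c d sa sb (lookup S x) (dominated S x)) (==-no x≢a) (==-no x≢b))
                                          (vertex₁-off c d sa sb (lookup S x) (dominated S x)))

  nbhd₂-formula : ∀ W → nbhdCard (adjM₂ M a b) W ≡ R₂ (profile W) + outside (body W)
  nbhd₂-formula (c ∷ d ∷ S) =
    trans (nbhd-split (adjM₂ M a b) c d S) (regroup at-c at-d at-a at-b (count-cong (away₂-cong a b rest)))
    where
    sa sb : Bool
    sa = lookup S a
    sb = lookup S b
    a-or-b : anyᶠ (λ u → lookup S u ∧ ((u == a) ∨ (u == b))) ≡ sa ∨ sb
    a-or-b = trans (anyᶠ-cong (λ u → ∧-distribˡ-∨ (lookup S u) (u == a) (u == b)))
      (trans (anyᶠ-∨ (λ u → lookup S u ∧ (u == a)) (λ u → lookup S u ∧ (u == b)))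
             (cong₂ _∨_ (anyᶠ-member a (lookup S)) (anyᶠ-member b (lookup S))))
    at-c : not c ∧ ((c ∧ false) ∨ ((d ∧ false) ∨ anyᶠ (λ u → lookup S u ∧ ((u == a) ∨ (u == b))))) ≡ not c ∧ (sa ∨ sb)
    at-c = cong₂ (λ x y → not c ∧ (x ∨ y)) (∧-zeroʳ c) (cong₂ _∨_ (∧-zeroʳ d) a-or-b)
    at-d : not d ∧ ((c ∧ false) ∨ ((d ∧ false) ∨ anyᶠ (λ u → lookup S u ∧ ((u == a) ∨ (u == b))))) ≡ not d ∧ (sa ∨ sb)
    at-d = cong₂ (λ x y → not d ∧ (x ∨ y)) (∧-zeroʳ c) (cong₂ _∨_ (∧-zeroʳ d) a-or-b)
    at-a : vertex₂ c d sa (dominated S a) (a == a) (a == b) ≡ not sa ∧ (c ∨ (d ∨ dominated S a))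
    at-a = vertex₂-on c d sa (dominated S a) (a == a) (a == b) (cong (_∨ (a == b)) (==-refl a))
    at-b : vertex₂ c d sb (dominated S b) (b == a) (b == b) ≡ not sb ∧ (c ∨ (d ∨ dominated S b))
    at-b = vertex₂-on c d sb (dominated S b) (b == a) (b == b)
             (trans (cong (_∨ (b == b)) (==-no b≢a)) (==-refl b))
    rest : ∀ x → x ≢ a → x ≢ b → vertex₂ c d (lookup S x) (dominated S x) (x == a) (x == b) ≡ inNbhd S x
    rest x x≢a x≢b = trans (cong₂ (vertex₂ c d (lookup S x) (dominated S x)) (==-no x≢a) (==-no x≢b))
                           (vertex₂-off c d (lookup S x) (dominated S x))

  exchange : Bool → Bool → Subset (suc (suc n)) → Subset (suc (suc n))
  exchange true  _     (c ∷ d ∷ S) = not c ∷ d ∷ toggle b S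
  exchange false true  (c ∷ d ∷ S) = c ∷ not d ∷ toggle a S
  exchange false false W           = W

  τ : Subset (suc (suc n)) → Subset (suc (suc n))
  τ W = exchange (inCB (profile W)) (inDA (profile W)) W

  -- Toggling b (resp. a) affects neither whether a nor whether b is dominated.
  profile-exchange : ∀ x y W → profile (exchange x y W) ≡ exchangeᵖ x y (profile W)
  profile-exchange true  _    (c ∷ d ∷ S) =
    ⟨⟩-cong (lookup-toggle-other b a S a≢b) (lookup-toggle-self b S)
            (dominated-toggle-nonadj b a S b≁a) (dominated-toggle-nonadj b b S (irrefl M b))
  profile-exchange false true (c ∷ d ∷ S) =
    ⟨⟩-cong (lookup-toggle-self a S) (lookup-toggle-other a b S b≢a)
            (dominated-toggle-nonadj a a S (irrefl M a)) (dominated-toggle-nonadj a b S a≁b)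
  profile-exchange false false W = refl

  profile-τ : ∀ W → profile (τ W) ≡ τᵖ (profile W)
  profile-τ W = profile-exchange (inCB (profile W)) (inDA (profile W)) W

  exchange-involutive : ∀ x y W → exchange x y (exchange x y W) ≡ W
  exchange-involutive true  _    (c ∷ d ∷ S) = cong₂ (λ e S′ → e ∷ d ∷ S′) (not-involutive c) (toggle-involutive b S)
  exchange-involutive false true (c ∷ d ∷ S) = cong₂ (λ e S′ → c ∷ e ∷ S′) (not-involutive d) (toggle-involutive a S)
  exchange-involutive false false W = refl

  -- τ is an involution, since the exchange keeps W in its region.
  τ-involutive : ∀ W → τ (τ W) ≡ W
  τ-involutive W = begin
    exchange (inCB (profile (τ W))) (inDA (profile (τ W))) (τ W)
      ≡⟨ cong (λ p → exchange (inCB p) (inDA p) (τ W)) (profile-τ W) ⟩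
    exchange (inCB (τᵖ p)) (inDA (τᵖ p)) (τ W)
      ≡⟨ cong₂ (λ x y → exchange x y (τ W)) (inCB-τᵖ p) (inDA-τᵖ p) ⟩
    exchange (inCB p) (inDA p) (exchange (inCB p) (inDA p) W)
      ≡⟨ exchange-involutive (inCB p) (inDA p) W ⟩
    W ∎
    where
    p : Profile
    p = profile W

  -- τ preserves |W|: it trades c for b, or d for a, when exactly one of them is in W.
  card-τ : ∀ W → card (τ W) ≡ card W
  card-τ (c ∷ d ∷ S) with inCB (profile (c ∷ d ∷ S)) in cb | inDA (profile (c ∷ d ∷ S)) in da
  ... | true  | _    = begin
    card (not c ∷ d ∷ toggle b S)                      ≡⟨ countᵇ≡count (lookup (not c ∷ d ∷ toggle b S)) ⟩
    ι (not c) + (ι d + count (lookup (toggle b S)))    ≡⟨ +-left-comm (ι (not c)) (ι d) _ ⟩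
    ι d + (ι (not c) + count (lookup (toggle b S)))
      ≡⟨ cong (ι d +_) (card-pair b S (proj₂ (inCB-sound {c} {d} {lookup S a} {lookup S b} {dominated S a} {dominated S b} cb))) ⟩
    ι d + (ι c + count (lookup S))                     ≡⟨ +-left-comm (ι d) (ι c) _ ⟩
    ι c + (ι d + count (lookup S))                     ≡⟨ sym (countᵇ≡count (lookup (c ∷ d ∷ S))) ⟩
    card (c ∷ d ∷ S) ∎
  ... | false | true = begin
    card (c ∷ not d ∷ toggle a S)                      ≡⟨ countᵇ≡count (lookup (c ∷ not d ∷ toggle a S)) ⟩
    ι c + (ι (not d) + count (lookup (toggle a S)))
      ≡⟨ cong (ι c +_) (card-pair a S (proj₂ (inDA-sound {c} {d} {lookup S a} {lookup S b} {dominated S a} {dominated S b} da))) ⟩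
    ι c + (ι d + count (lookup S))                     ≡⟨ sym (countᵇ≡count (lookup (c ∷ d ∷ S))) ⟩
    card (c ∷ d ∷ S) ∎
  ... | false | false = refl

  -- τ preserves |N_M(S) \ {a, b}|: in region CB the vertex a is dominated, so toggling b
  -- does not change N_M(S) off b; symmetrically in region DA.
  outside-τ : CommonUniversal a b → PrivateComplete a b ⊎ PrivateComplete b a →
    ∀ W → outside (body (τ W)) ≡ outside (body W)
  outside-τ common complete (c ∷ d ∷ S) with inCB (profile (c ∷ d ∷ S)) in cb | inDA (profile (c ∷ d ∷ S)) in da
  ... | true  | _    = count-cong (away₂-cong a b λ x _ x≢b →
    inNbhd-toggle common complete b≁a S
      (proj₁ (inCB-sound {c} {d} {lookup S a} {lookup S b} {dominated S a} {dominated S b} cb)) x x≢b)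
  ... | false | true = count-cong (away₂-cong a b λ x x≢a _ →
    inNbhd-toggle (CommonUniversal-sym common) (⊎-swap complete) a≁b S
      (proj₁ (inDA-sound {c} {d} {lookup S a} {lookup S b} {dominated S a} {dominated S b} da)) x x≢a)
  ... | false | false = refl

  nbhd-τ : CommonUniversal a b → PrivateComplete a b ⊎ PrivateComplete b a →
    ∀ W → nbhdCard (adjM₂ M a b) (τ W) ≡ nbhdCard (adjM₁ M a b) W
  nbhd-τ common complete W = begin
    nbhdCard (adjM₂ M a b) (τ W)               ≡⟨ nbhd₂-formula (τ W) ⟩
    R₂ (profile (τ W)) + outside (body (τ W))  ≡⟨ cong₂ _+_ (cong R₂ (profile-τ W)) (outside-τ common complete W) ⟩
    R₂ (τᵖ (profile W)) + outside (body W)     ≡⟨ cong (_+ outside (body W)) (R-exchange (profile W)) ⟩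
    R₁ (profile W) + outside (body W)          ≡⟨ sym (nbhd₁-formula W) ⟩
    nbhdCard (adjM₁ M a b) W ∎

theorem2 : (n : ℕ) (M : SimpleGraph n) (a b : Fin n) →
    a ≢ b →
    adj M a b ≡ false →
    (∀ v → adj M a v ≡ true → adj M b v ≡ true → ∀ u → u ≢ v → adj M v u ≡ true) →
    ((∀ u v → adj M a u ≡ true → adj M b u ≡ false → adj M b v ≡ true → adj M u v ≡ true)
    ⊎ (∀ u v → adj M b u ≡ true → adj M a u ≡ false → adj M a v ≡ true → adj M u v ≡ true)) →
    ∀ i j → J (adjM₁ M a b) i j ≡ J (adjM₂ M a b) i j
theorem2 n M a b a≢b a≁b common complete i j = begin
  J (adjM₁ M a b) i j        ≡⟨ length-filter-subsets (suc (suc n)) P₁ ⟩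
  sumₛ (ι ∘ P₁)              ≡⟨ sumₛ-cong (λ W → cong ι (P₁≡P₂∘τ W)) ⟩
  sumₛ (ι ∘ P₂ ∘ τ)          ≡⟨ sumₛ-involution τ τ-involutive (ι ∘ P₂) ⟩
  sumₛ (ι ∘ P₂)              ≡⟨ sym (length-filter-subsets (suc (suc n)) P₂) ⟩
  J (adjM₂ M a b) i j ∎
  where
  open Extensions M a b a≢b a≁b
  P₁ P₂ : Subset (suc (suc n)) → Bool
  P₁ W = ⌊ card W ℕ.≟ i ⌋ ∧ ⌊ nbhdCard (adjM₁ M a b) W ℕ.≟ j ⌋
  P₂ W = ⌊ card W ℕ.≟ i ⌋ ∧ ⌊ nbhdCard (adjM₂ M a b) W ℕ.≟ j ⌋
  P₁≡P₂∘τ : ∀ W → P₁ W ≡ P₂ (τ W)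
  P₁≡P₂∘τ W = cong₂ (λ k m → ⌊ k ℕ.≟ i ⌋ ∧ ⌊ m ℕ.≟ j ⌋) (sym (card-τ W)) (sym (nbhd-τ common complete W))
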